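{- Let $n\ge1$ and let $\mathcal M_1,\dots,\mathcal M_f$ be finitely many minions such that each $\mathcal M_i$ is $(n,k_i)$-representable. Then the product $\prod_i\mathcal M_i$ is $(n,\prod_i k_i)$-representable.
   Context: Write $n=\{0,\dots,n-1\}$. A minion $\mathcal M$ consists of sets $\mathcal M_l$ ($l\ge1$) and maps $f\mapsto f\alpha$ for each map $\alpha:l\to m$, with $f\,\mathrm{id}=f$, $(f\alpha)\beta=f(\beta\circ\alpha)$. The product $\prod_i\mathcal M_i$ has arity-$l$ set $\prod_i(\mathcal M_i)_l$ with minor maps acting componentwise. $\mathcal O(n,k)_l$ is the set of functions $n^l\to k$ with $(f\alpha)(x_0,\dots,x_{m-1})=f(x_{\alpha(0)},\dots,x_{\alpha(l-1)})$. A minion is $(n,k)$-representable if there is an arity-wise injective family of maps into $\mathcal O(n,k)$ commuting with the minor maps. -}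

module Defs where

open import Level using (Level; _⊔_)
open import Data.Nat using (ℕ; suc)
open import Data.Fin using (Fin)
open import Data.Nat.ListAction using (product)
open import Data.Vec.Functional using (toList)
open import Function using (_∘_; id)
open import Relation.Binary using (IsEquivalence)
open import Relation.Binary.PropositionalEquality using (_≡_)

-- Arity convention: an index l : ℕ stands for the arity  suc l  (arities are ≥ 1),
-- and the set of arity  suc l  is  Fin (suc l) = {0,…,l}.
-- Sets are modelled as setoids (carrier + equivalence), as is usual in Agda
-- without function extensionality.

record Minion (c ℓ : Level) : Set (Level.suc (c ⊔ ℓ)) where
  field
    M      : ℕ → Set c
    _≈_    : ∀ {l} → M l → M l → Set ℓ
    isEq   : ∀ {l} → IsEquivalence (_≈_ {l})
    minor  : ∀ {l m} → M l → (Fin (suc l) → Fin (suc m)) → M m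
    minor-cong : ∀ {l m} {f g : M l} (α : Fin (suc l) → Fin (suc m)) →
                 f ≈ g → minor f α ≈ minor g α
    minor-id   : ∀ {l} (f : M l) → minor f id ≈ f
    minor-comp : ∀ {l m p} (f : M l) (α : Fin (suc l) → Fin (suc m))
                   (β : Fin (suc m) → Fin (suc p)) →
                 minor (minor f α) β ≈ minor f (β ∘ α)

Π-minion : ∀ {c ℓ} {r : ℕ} → (Fin r → Minion c ℓ) → Minion c ℓ
Π-minion {r = r} Ms = record
  { M = λ l → (i : Fin r) → Minion.M (Ms i) l
  ; _≈_ = λ f g → (i : Fin r) → Minion._≈_ (Ms i) (f i) (g i)
  ; isEq = record
      { refl  = λ {f} i → IsEquivalence.refl (Minion.isEq (Ms i))
      ; sym   = λ p i → IsEquivalence.sym (Minion.isEq (Ms i)) (p i)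
      ; trans = λ p q i → IsEquivalence.trans (Minion.isEq (Ms i)) (p i) (q i)
      }
  ; minor = λ f α i → Minion.minor (Ms i) (f i) α
  ; minor-cong = λ α p i → Minion.minor-cong (Ms i) α (p i)
  ; minor-id = λ f i → Minion.minor-id (Ms i) (f i)
  ; minor-comp = λ f α β i → Minion.minor-comp (Ms i) (f i) α β
  }

-- The function minion O(n,k): arity-(suc l) elements are functions n^(suc l) → k,
-- tuples being  Fin (suc l) → Fin n; equality of functions is pointwise equality.
O-M : ℕ → ℕ → ℕ → Set
O-M n k l = (Fin (suc l) → Fin n) → Fin k

O-≈ : ∀ {n k l} → O-M n k l → O-M n k l → Set
O-≈ f g = ∀ x → f x ≡ g x

O-minor : ∀ {n k l m} → O-M n k l → (Fin (suc l) → Fin (suc m)) → O-M n k m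
O-minor f α x = f (x ∘ α)

record Representation {c ℓ} (Mn : Minion c ℓ) (n k : ℕ) : Set (c ⊔ ℓ) where
  open Minion Mn
  field
    ξ        : ∀ {l} → M l → O-M n k l
    ξ-cong   : ∀ {l} {f g : M l} → f ≈ g → O-≈ (ξ f) (ξ g)
    ξ-inj    : ∀ {l} {f g : M l} → O-≈ (ξ f) (ξ g) → f ≈ g
    ξ-minor  : ∀ {l m} (f : M l) (α : Fin (suc l) → Fin (suc m)) →
               O-≈ (ξ (minor f α)) (O-minor (ξ f) α)

Representable : ∀ {c ℓ} → Minion c ℓ → ℕ → ℕ → Set (c ⊔ ℓ)
Representable Mn n k = Representation Mn n k

Πℕ : ∀ {r} → (Fin r → ℕ) → ℕ
Πℕ ks = product (toList ks)

{-# OPTIONS --safe #-}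
-- Encode an r-tuple of values in k₁, …, k_r injectively as a single value in
-- k₁ ⋯ k_r (mixed radix).  Post-composing the componentwise representations
-- ξᵢ with this encoding represents the product minion: minors act on the
-- inputs only, so they commute with any post-composition, and injectivity of
-- the encoding reduces injectivity to that of each ξᵢ.
module Submission where

open import Defs
open import Level using (Level)
open import Data.Nat using (ℕ; _≥_)
open import Data.Fin using (Fin; zero; suc; combine)
open import Data.Fin.Properties using (combine-injectiveˡ; combine-injectiveʳ)
open import Function using (_∘_)
open import Relation.Binary.PropositionalEquality using (_≡_; refl; cong₂)

combineΠ : ∀ {r} (ks : Fin r → ℕ) → ((i : Fin r) → Fin (ks i)) → Fin (Πℕ ks)
combineΠ {ℕ.zero}  ks x = zero
combineΠ {ℕ.suc r} ks x = combine (x zero) (combineΠ (ks ∘ suc) (x ∘ suc))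

combineΠ-cong : ∀ {r} (ks : Fin r → ℕ) {x y : (i : Fin r) → Fin (ks i)} →
                (∀ i → x i ≡ y i) → combineΠ ks x ≡ combineΠ ks y
combineΠ-cong {ℕ.zero}  ks x≗y = refl
combineΠ-cong {ℕ.suc r} ks x≗y =
  cong₂ combine (x≗y zero) (combineΠ-cong (ks ∘ suc) (x≗y ∘ suc))

combineΠ-injective : ∀ {r} (ks : Fin r → ℕ) {x y : (i : Fin r) → Fin (ks i)} →
                     combineΠ ks x ≡ combineΠ ks y → ∀ i → x i ≡ y i
combineΠ-injective {ℕ.suc r} ks {x} {y} eq zero =
  combine-injectiveˡ (x zero) _ (y zero) _ eq
combineΠ-injective {ℕ.suc r} ks {x} {y} eq (suc i) =
  combineΠ-injective (ks ∘ suc)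
    (combine-injectiveʳ (x zero) _ (y zero) _ eq) i

proposition5p2p2 : ∀ {c ℓ : Level} (n : ℕ) → n ≥ 1 → (r : ℕ)
                     (Ms : Fin r → Minion c ℓ) (ks : Fin r → ℕ) →
                     ((i : Fin r) → Representable (Ms i) n (ks i)) →
                     Representable (Π-minion Ms) n (Πℕ ks)
proposition5p2p2 n _ r Ms ks R = record
  { ξ       = λ f x → combineΠ ks (λ i → ξ (R i) (f i) x)
  ; ξ-cong  = λ f≈g x → combineΠ-cong ks (λ i → ξ-cong (R i) (f≈g i) x)
  ; ξ-inj   = λ ξf≗ξg i → ξ-inj (R i) (λ x → combineΠ-injective ks (ξf≗ξg x) i)
  ; ξ-minor = λ f α x → combineΠ-cong ks (λ i → ξ-minor (R i) (f i) α x)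
  }
  where open Representation
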